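{- Let $G$ be a minimally nonperfectly divisible graph, $X$ a clique of $G$, and $V(G)\setminus X=V_1\cup V_2$ a partition into nonempty sets with no edges between $V_1$ and $V_2$. Let $G_i=G[X\cup V_i]$ for $i=1,2$. Then there exist perfect divisions $(A_i,B_i)$ of $G_i$, $i=1,2$, such that (a) for every $x\in X\cap A_1\cap B_2$, $\omega(G[B_1\cup\{x\}])=\omega(G_1)$ and $G[A_2\cup\{x\}]$ is not perfect; and (b) for every $x\in X\cap A_2\cap B_1$, $\omega(G[B_2\cup\{x\}])=\omega(G_2)$ and $G[A_1\cup\{x\}]$ is not perfect.
   Context: A perfect division of a graph $H$ is a partition $(A,B)$ of $V(H)$ such that $H[A]$ is perfect and $\omega(H[B])<\omega(H)$. $G$ is perfectly divisible if every nonempty induced subgraph has a perfect division; $G$ is minimally nonperfectly divisible if $G$ is not perfectly divisible but every proper induced subgraph is. -}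

module Defs where

open import Data.Nat using (ℕ; zero; suc; _<_; _⊔_)
open import Data.Fin using (Fin; _≟_)
open import Data.Fin.Subset using (Subset; inside; outside; _∈_; _∉_; _⊆_; _⊂_; _∪_; _∩_; ∁; ⁅_⁆; ∣_∣; ⊥; ⊤; Nonempty; Empty)
open import Data.Fin.Subset.Properties using (_∈?_; _⊆?_)
open import Data.Fin.Properties using (all?)
open import Data.Vec using ([]; _∷_)
open import Data.List using (List; []; _∷_; _++_; map; foldr; filter)
open import Data.Product using (Σ; ∃; ∃₂; _×_; _,_)
open import Relation.Nullary using (¬_; Dec; yes; no)
open import Relation.Nullary.Decidable using (_→-dec_; _×-dec_; ¬?)
open import Relation.Binary.PropositionalEquality using (_≡_; _≢_)

record Graph (n : ℕ) : Set₁ where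
  field
    Adj   : Fin n → Fin n → Set
    adj?  : (u v : Fin n) → Dec (Adj u v)
    sym   : ∀ {u v} → Adj u v → Adj v u
    irrefl : ∀ {v} → ¬ Adj v v
open Graph public

module _ {n : ℕ} (G : Graph n) where

  IsClique : Subset n → Set
  IsClique K = ∀ u v → u ∈ K → v ∈ K → u ≢ v → Adj G u v

  isClique? : (K : Subset n) → Dec (IsClique K)
  isClique? K = all? λ u → all? λ v →
    (u ∈? K) →-dec (v ∈? K) →-dec ¬? (u ≟ v) →-dec adj? G u v

allSubsets : (n : ℕ) → List (Subset n)
allSubsets zero = [] ∷ []
allSubsets (suc n) = map (inside ∷_) (allSubsets n) ++ map (outside ∷_) (allSubsets n)

module _ {n : ℕ} (G : Graph n) where

  ω : Subset n → ℕ
  ω S = foldr _⊔_ 0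
          (map ∣_∣ (filter (λ K → (K ⊆? S) ×-dec isClique? G K) (allSubsets n)))

  Colourable : Subset n → ℕ → Set
  Colourable S k = Σ ((v : Fin n) → v ∈ S → Fin k) λ c →
    ∀ u v (u∈S : u ∈ S) (v∈S : v ∈ S) → Adj G u v → c u u∈S ≢ c v v∈S

  -- G[S] is perfect: every induced subgraph G[T] (T ⊆ S) has χ(G[T]) = ω(G[T]),
  -- i.e. (since χ ≥ ω always) G[T] is colourable with ω(G[T]) colours.
  Perfect : Subset n → Set
  Perfect S = ∀ T → T ⊆ S → Colourable T (ω T)

  PerfectDivision : Subset n → Subset n → Subset n → Set
  PerfectDivision S A B =
    (A ∪ B ≡ S) × (A ∩ B ≡ ⊥) × Perfect A × (ω B < ω S)

  PerfectlyDivisible : Subset n → Set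
  PerfectlyDivisible S = ∀ T → T ⊆ S → Nonempty T → ∃₂ λ A B → PerfectDivision T A B

  MinimallyNonPerfectlyDivisible : Set
  MinimallyNonPerfectlyDivisible =
    ¬ PerfectlyDivisible ⊤ × (∀ S → S ⊂ ⊤ → PerfectlyDivisible S)

{-# OPTIONS --safe #-}
-- Start from perfect divisions (A₁ , B₁) of G₁ and (A₂ , B₂) of G₂, which exist by minimality
-- because each Gᵢ misses the nonempty set V₃₋ᵢ, and call the vertices of A₁ ∩ B₂ ∪ A₂ ∩ B₁ the
-- conflicts of the pair. If some x ∈ X ∩ A₁ ∩ B₂ violates (a), then either ω(B₁ ∪ {x}) < ω(G₁)
-- and x can be moved from A₁ to B₁, or A₂ ∪ {x} is perfect and x can be moved from B₂ to A₂.
-- Either move yields a pair of perfect divisions whose conflict set is strictly smaller: x stops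
-- being a conflict, and no new conflict appears because x already lies in A₁ and in B₂.
-- Well-founded descent on ⊂ therefore ends at a pair satisfying (a) and (b). Constructively the
-- descent needs "some conflict violates (a) or (b)" to be decidable, which it is because the
-- colourings of a finite graph can be enumerated.
module Submission where

open import Data.Bool.Properties using (∨-identityʳ)
open import Data.Empty using (⊥-elim)
open import Data.Fin using (Fin; zero; _≟_)
open import Data.Fin.Properties using (any?; all?; ¬Fin0)
open import Data.Fin.Subset
open import Data.Fin.Subset.Induction using (⊂-wellFounded)
open import Data.Fin.Subset.Properties
open import Data.List using ([]; _∷_; map; foldr; filter)
open import Data.Nat using (ℕ; zero; suc; _≤_; _<_; _⊔_; z≤n; _<?_)
open import Data.Nat.Properties using (≤-<-trans; ≤-antisym; ≮⇒≥; ⊔-monoʳ-≤; m≤n⇒m≤o⊔n)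
open import Data.Product using (∃; ∃₂; _×_; _,_)
open import Data.Sum using (_⊎_; inj₁; inj₂; [_,_]′)
open import Data.Vec using (Vec; []; _∷_; here; there; lookup; tabulate)
open import Data.Vec.Properties using (lookup∘tabulate)
open import Function using (_∘_)
open import Induction.WellFounded using (WellFounded; Acc; acc)
open import Relation.Binary using (Rel)
import Relation.Binary.Construct.On as On
open import Relation.Binary.PropositionalEquality
  using (_≡_; _≢_; refl; sym; trans; cong; cong₂; subst; subst₂; module ≡-Reasoning)
open import Relation.Nullary using (¬_; Dec; yes; no)
open import Relation.Nullary.Decidable using (map′; ¬?; _×-dec_; _⊎-dec_; _→-dec_; decidable-stable)
open import Relation.Unary using (Pred; Decidable)

open import Defs hiding (sym)

module _ {a r p} {A : Set a} {_<_ : Rel A r} {P : Pred A p} where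

  descent : WellFounded _<_ → (∀ x → P x ⊎ ∃ λ y → y < x) → A → ∃ P
  descent wf step x = go (wf x)
    where
    go : ∀ {x} → Acc _<_ x → ∃ P
    go {x} (acc rs) with step x
    ... | inj₁ px       = x , px
    ... | inj₂ (y , y<x) = go (rs y<x)

any?-Vec : ∀ {k m p} {P : Pred (Vec (Fin k) m) p} → Decidable P → Dec (∃ P)
any?-Vec {m = zero}  P? = map′ ([] ,_) (λ { ([] , p) → p }) (P? [])
any?-Vec {m = suc m} P? =
  map′ (λ (c , cs , p) → c ∷ cs , p) (λ { (c ∷ cs , p) → c , cs , p })
       (any? λ c → any?-Vec (P? ∘ (c ∷_)))

foldr-⊔-filter-mono : ∀ {a p q} {A : Set a} {P : Pred A p} {Q : Pred A q}
  (P? : Decidable P) (Q? : Decidable Q) (f : A → ℕ) → (∀ {x} → P x → Q x) → ∀ xs →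
  foldr _⊔_ 0 (map f (filter P? xs)) ≤ foldr _⊔_ 0 (map f (filter Q? xs))
foldr-⊔-filter-mono P? Q? f P⇒Q []       = z≤n
foldr-⊔-filter-mono P? Q? f P⇒Q (x ∷ xs) with P? x | Q? x
... | yes _  | yes _  = ⊔-monoʳ-≤ (f x) (foldr-⊔-filter-mono P? Q? f P⇒Q xs)
... | yes px | no ¬qx = ⊥-elim (¬qx (P⇒Q px))
... | no _   | yes _  = m≤n⇒m≤o⊔n (f x) (foldr-⊔-filter-mono P? Q? f P⇒Q xs)
... | no _   | no _   = foldr-⊔-filter-mono P? Q? f P⇒Q xs

private
  variable
    n : ℕ

x∈p─q⇒x∉q : {p q : Subset n} {x : Fin n} → x ∈ p ─ q → x ∉ q
x∈p─q⇒x∉q {p = _ ∷ _} {_ ∷ _} ()  here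
x∈p─q⇒x∉q {p = _ ∷ _} {_ ∷ _} x∈p (there x∈q) = x∈p─q⇒x∉q (drop-there x∈p) x∈q

x∈p-y⇒x≢y : {p : Subset n} {x y : Fin n} → x ∈ p - y → x ≢ y
x∈p-y⇒x≢y = x∉⁅y⁆⇒x≢y ∘ x∈p─q⇒x∉q

x∈p⇒p-x∪⁅x⁆≡p : {p : Subset n} {x : Fin n} → x ∈ p → (p - x) ∪ ⁅ x ⁆ ≡ p
x∈p⇒p-x∪⁅x⁆≡p {p = inside ∷ p} here = cong (inside ∷_) (trans (∪-identityʳ (p ─ ⊥)) (p─⊥≡p p))
x∈p⇒p-x∪⁅x⁆≡p {p = s ∷ p} (there x∈p) = cong₂ _∷_ (∨-identityʳ s) (x∈p⇒p-x∪⁅x⁆≡p x∈p)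

p∩q≡⊥⇒x∈p⇒x∉q : {p q : Subset n} {x : Fin n} → p ∩ q ≡ ⊥ → x ∈ p → x ∉ q
p∩q≡⊥⇒x∈p⇒x∉q p∩q≡⊥ x∈p x∈q = ∉⊥ (subst (_ ∈_) p∩q≡⊥ (x∈p∩q⁺ (x∈p , x∈q)))

p⊆r⇒x∈r⇒p∪⁅x⁆⊆r : {p r : Subset n} {x : Fin n} → p ⊆ r → x ∈ r → p ∪ ⁅ x ⁆ ⊆ r
p⊆r⇒x∈r⇒p∪⁅x⁆⊆r {p = p} {x = x} p⊆r x∈r y∈ with x∈p∪q⁻ p ⁅ x ⁆ y∈
... | inj₁ y∈p    = p⊆r y∈p
... | inj₂ y∈⁅x⁆ = subst (_∈ _) (sym (x∈⁅y⁆⇒x≡y x y∈⁅x⁆)) x∈r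

move-partition : {A B S : Subset n} {x : Fin n} → A ∪ B ≡ S → A ∩ B ≡ ⊥ → x ∈ A →
  (A - x) ∪ (B ∪ ⁅ x ⁆) ≡ S × (A - x) ∩ (B ∪ ⁅ x ⁆) ≡ ⊥
move-partition {A = A} {B} {S} {x} A∪B≡S A∩B≡⊥ x∈A = covers , ⊆-antisym disjoint (⊆-min _)
  where
  open ≡-Reasoning
  covers : (A - x) ∪ (B ∪ ⁅ x ⁆) ≡ S
  covers = begin
    (A - x) ∪ (B ∪ ⁅ x ⁆)  ≡⟨ cong ((A - x) ∪_) (∪-comm B ⁅ x ⁆) ⟩
    (A - x) ∪ (⁅ x ⁆ ∪ B)  ≡⟨ ∪-assoc (A - x) ⁅ x ⁆ B ⟨
    ((A - x) ∪ ⁅ x ⁆) ∪ B  ≡⟨ cong (_∪ B) (x∈p⇒p-x∪⁅x⁆≡p x∈A) ⟩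
    A ∪ B                  ≡⟨ A∪B≡S ⟩
    S                      ∎
  disjoint : (A - x) ∩ (B ∪ ⁅ x ⁆) ⊆ ⊥
  disjoint y∈ with x∈p∩q⁻ (A - x) _ y∈
  ... | y∈A-x , y∈B∪⁅x⁆ = ⊥-elim ([ p∩q≡⊥⇒x∈p⇒x∉q A∩B≡⊥ (p─q⊆p A _ y∈A-x)
                                  , x∈p-y⇒x≢y y∈A-x ∘ x∈⁅y⁆⇒x≡y x
                                  ]′ (x∈p∪q⁻ B ⁅ x ⁆ y∈B∪⁅x⁆))

X∪V₁⊂⊤ : {X V₁ V₂ : Subset n} {v : Fin n} → V₁ ∩ V₂ ≡ ⊥ → V₁ ∪ V₂ ≡ ∁ X → v ∈ V₂ → X ∪ V₁ ⊂ ⊤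
X∪V₁⊂⊤ {X = X} {V₁} {v = v} V₁∩V₂≡⊥ V₁∪V₂≡∁X v∈V₂ =
  ⊆⊤ , v , ∈⊤ , [ x∈∁p⇒x∉p (subst (v ∈_) V₁∪V₂≡∁X (x∈p∪q⁺ (inj₂ v∈V₂)))
                , (λ v∈V₁ → p∩q≡⊥⇒x∈p⇒x∉q V₁∩V₂≡⊥ v∈V₁ v∈V₂)
                ]′ ∘ x∈p∪q⁻ X V₁

conflictSet : Subset n → Subset n → Subset n → Subset n → Subset n
conflictSet A₁ B₁ A₂ B₂ = A₁ ∩ B₂ ∪ A₂ ∩ B₁

conflictSet-flip : ∀ (A₁ B₁ A₂ B₂ : Subset n) → conflictSet A₁ B₁ A₂ B₂ ≡ conflictSet B₂ A₂ B₁ A₁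
conflictSet-flip A₁ B₁ A₂ B₂ = cong₂ _∪_ (∩-comm A₁ B₂) (∩-comm A₂ B₁)

conflictSet-moveˡ : {A₁ B₁ A₂ B₂ : Subset n} {x : Fin n} → x ∉ A₂ →
  conflictSet (A₁ - x) (B₁ ∪ ⁅ x ⁆) A₂ B₂ ⊆ conflictSet A₁ B₁ A₂ B₂ - x
conflictSet-moveˡ {A₁ = A₁} {B₁} {A₂} {B₂} {x} x∉A₂ y∈ with x∈p∪q⁻ ((A₁ - x) ∩ B₂) _ y∈
... | inj₁ y∈A₁-x∩B₂ =
  let y∈A₁-x , y∈B₂ = x∈p∩q⁻ (A₁ - x) B₂ y∈A₁-x∩B₂
  in x∈p∧x≢y⇒x∈p-y (x∈p∪q⁺ (inj₁ (x∈p∩q⁺ (p─q⊆p A₁ _ y∈A₁-x , y∈B₂)))) (x∈p-y⇒x≢y y∈A₁-x)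
... | inj₂ y∈A₂∩B₁∪⁅x⁆ with x∈p∩q⁻ A₂ (B₁ ∪ ⁅ x ⁆) y∈A₂∩B₁∪⁅x⁆
...   | y∈A₂ , y∈B₁∪⁅x⁆ with x∈p∪q⁻ B₁ ⁅ x ⁆ y∈B₁∪⁅x⁆
...     | inj₁ y∈B₁   = x∈p∧x≢y⇒x∈p-y (x∈p∪q⁺ (inj₂ (x∈p∩q⁺ (y∈A₂ , y∈B₁))))
                                        (λ { refl → x∉A₂ y∈A₂ })
...     | inj₂ y∈⁅x⁆ = ⊥-elim (x∉A₂ (subst (_∈ A₂) (x∈⁅y⁆⇒x≡y x y∈⁅x⁆) y∈A₂))

conflictSet-moveʳ : {A₁ B₁ A₂ B₂ : Subset n} {x : Fin n} → x ∉ B₁ →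
  conflictSet A₁ B₁ (A₂ ∪ ⁅ x ⁆) (B₂ - x) ⊆ conflictSet A₁ B₁ A₂ B₂ - x
conflictSet-moveʳ {A₁ = A₁} {B₁} {A₂} {B₂} {x} x∉B₁ =
  subst₂ _⊆_ (sym (conflictSet-flip A₁ B₁ (A₂ ∪ ⁅ x ⁆) (B₂ - x)))
             (cong (_- x) (sym (conflictSet-flip A₁ B₁ A₂ B₂)))
             (conflictSet-moveˡ {A₁ = B₂} {A₂} {B₁} {A₁} x∉B₁)

module _ {n : ℕ} (G : Graph n) where

  ω-mono : {S S′ : Subset n} → S ⊆ S′ → ω G S ≤ ω G S′
  ω-mono {S} {S′} S⊆S′ =
    foldr-⊔-filter-mono (λ K → (K ⊆? S) ×-dec isClique? G K) (λ K → (K ⊆? S′) ×-dec isClique? G K)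
      ∣_∣ (λ (K⊆S , K-clique) → ⊆-trans K⊆S S⊆S′ , K-clique) (allSubsets n)

  perfect-⊆ : {A A′ : Subset n} → A′ ⊆ A → Perfect G A → Perfect G A′
  perfect-⊆ A′⊆A perfect T T⊆A′ = perfect T (⊆-trans T⊆A′ A′⊆A)

  ProperOn : ∀ {k} → Subset n → (Fin n → Fin k) → Set
  ProperOn T f = ∀ u v → u ∈ T → v ∈ T → Adj G u v → f u ≢ f v

  properOn? : ∀ {k} T (f : Fin n → Fin k) → Dec (ProperOn T f)
  properOn? T f = all? λ u → all? λ v →
    (u ∈? T) →-dec (v ∈? T) →-dec adj? G u v →-dec ¬? (f u ≟ f v)

  -- Colourings are searched as total vectors: a colouring of G[T] is extended by the colour 0,
  -- which exists unless k = 0, and then G[T] is k-colourable only if T is empty.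
  colourable? : ∀ T k → Dec (Colourable G T k)
  colourable? T zero = map′ colour-empty (λ (c , _) (v , v∈T) → ¬Fin0 (c v v∈T)) (¬? (nonempty? T))
    where
    colour-empty : Empty T → Colourable G T 0
    colour-empty T-empty = (λ v v∈T → ⊥-elim (T-empty (v , v∈T)))
                         , (λ u _ u∈T _ _ → ⊥-elim (T-empty (u , u∈T)))
  colourable? T (suc k) =
    map′ (λ (cs , proper) → (λ v _ → lookup cs v) , proper) tabulate-colouring
         (any?-Vec (properOn? T ∘ lookup))
    where
    extend : ((v : Fin n) → v ∈ T → Fin (suc k)) → Fin n → Fin (suc k)
    extend c v with v ∈? T
    ... | yes v∈T = c v v∈T
    ... | no _    = zero

    extend-∈ : ∀ c {v} → v ∈ T → ∃ λ v∈T → extend c v ≡ c v v∈T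
    extend-∈ c {v} v∈T with v ∈? T
    ... | yes v∈T′ = v∈T′ , refl
    ... | no v∉T   = ⊥-elim (v∉T v∈T)

    tabulate-colouring : Colourable G T (suc k) → ∃ λ cs → ProperOn T (lookup cs)
    tabulate-colouring (c , proper) = tabulate (extend c) , λ u v u∈T v∈T uv same →
      let u∈T′ , cu = extend-∈ c u∈T
          v∈T′ , cv = extend-∈ c v∈T
          open ≡-Reasoning
      in proper u v u∈T′ v∈T′ uv (begin
        c u u∈T′                      ≡⟨ cu ⟨
        extend c u                    ≡⟨ lookup∘tabulate (extend c) u ⟨
        lookup (tabulate (extend c)) u ≡⟨ same ⟩
        lookup (tabulate (extend c)) v ≡⟨ lookup∘tabulate (extend c) v ⟩
        extend c v                    ≡⟨ cv ⟩
        c v v∈T′                      ∎)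

  perfect? : ∀ S → Dec (Perfect G S)
  perfect? S with anySubset? (λ T → ¬? ((T ⊆? S) →-dec colourable? T (ω G T)))
  ... | yes (T , T-bad) = no λ perfect → T-bad (perfect T)
  ... | no no-bad       = yes λ T →
    decidable-stable ((T ⊆? S) →-dec colourable? T (ω G T)) (λ T-bad → no-bad (T , T-bad))

  move-to-B : {S A B : Subset n} {x : Fin n} → PerfectDivision G S A B → x ∈ A →
    ω G (B ∪ ⁅ x ⁆) < ω G S → PerfectDivision G S (A - x) (B ∪ ⁅ x ⁆)
  move-to-B {A = A} {x = x} (A∪B≡S , A∩B≡⊥ , A-perfect , _) x∈A small =
    let covers , disjoint = move-partition A∪B≡S A∩B≡⊥ x∈A
    in covers , disjoint , perfect-⊆ (p─q⊆p A ⁅ x ⁆) A-perfect , small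

  move-to-A : {S A B : Subset n} {x : Fin n} → PerfectDivision G S A B → x ∈ B →
    Perfect G (A ∪ ⁅ x ⁆) → PerfectDivision G S (A ∪ ⁅ x ⁆) (B - x)
  move-to-A {A = A} {B} {x} (A∪B≡S , A∩B≡⊥ , _ , small) x∈B perfect =
    let covers , disjoint = move-partition (trans (∪-comm B A) A∪B≡S) (trans (∩-comm B A) A∩B≡⊥) x∈B
    in  trans (∪-comm _ _) covers , trans (∩-comm _ _) disjoint , perfect
      , ≤-<-trans (ω-mono (p─q⊆p B ⁅ x ⁆)) small

record DivisionPair {n : ℕ} (G : Graph n) (S₁ S₂ : Subset n) : Set where
  constructor divisionPair
  field
    A₁ B₁ A₂ B₂ : Subset n
    division₁ : PerfectDivision G S₁ A₁ B₁
    division₂ : PerfectDivision G S₂ A₂ B₂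

module _ {n : ℕ} {G : Graph n} where

  private
    variable
      S₁ S₂ X : Subset n

  initial-pair : MinimallyNonPerfectlyDivisible G →
    S₁ ⊂ ⊤ → S₂ ⊂ ⊤ → Nonempty S₁ → Nonempty S₂ → DivisionPair G S₁ S₂
  initial-pair (_ , minimal) S₁⊂⊤ S₂⊂⊤ S₁≢∅ S₂≢∅ =
    let A₁ , B₁ , d₁ = minimal _ S₁⊂⊤ _ ⊆-refl S₁≢∅
        A₂ , B₂ , d₂ = minimal _ S₂⊂⊤ _ ⊆-refl S₂≢∅
    in  divisionPair A₁ B₁ A₂ B₂ d₁ d₂

  conflicts : DivisionPair G S₁ S₂ → Subset n
  conflicts (divisionPair A₁ B₁ A₂ B₂ _ _) = conflictSet A₁ B₁ A₂ B₂

  swap : DivisionPair G S₁ S₂ → DivisionPair G S₂ S₁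
  swap (divisionPair A₁ B₁ A₂ B₂ d₁ d₂) = divisionPair A₂ B₂ A₁ B₁ d₂ d₁

  conflicts-swap : (d : DivisionPair G S₁ S₂) → conflicts (swap d) ≡ conflicts d
  conflicts-swap (divisionPair A₁ B₁ A₂ B₂ _ _) = ∪-comm (A₂ ∩ B₁) (A₁ ∩ B₂)

  Reducible : DivisionPair G S₁ S₂ → Set
  Reducible {S₁ = S₁} {S₂} d = ∃ λ (d′ : DivisionPair G S₁ S₂) → conflicts d′ ⊂ conflicts d

  Settled : Subset n → DivisionPair G S₁ S₂ → Set
  Settled {S₁ = S₁} X (divisionPair A₁ B₁ A₂ B₂ _ _) = ∀ x → x ∈ X → x ∈ A₁ → x ∈ B₂ →
    (ω G (B₁ ∪ ⁅ x ⁆) ≡ ω G S₁) × ¬ Perfect G (A₂ ∪ ⁅ x ⁆)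

  Movable : Subset n → DivisionPair G S₁ S₂ → Fin n → Set
  Movable {S₁ = S₁} X (divisionPair A₁ B₁ A₂ B₂ _ _) x = x ∈ X × x ∈ A₁ × x ∈ B₂ ×
    (ω G (B₁ ∪ ⁅ x ⁆) < ω G S₁ ⊎ Perfect G (A₂ ∪ ⁅ x ⁆))

  movable? : ∀ X (d : DivisionPair G S₁ S₂) → Decidable (Movable X d)
  movable? {S₁ = S₁} X (divisionPair A₁ B₁ A₂ B₂ _ _) x =
    (x ∈? X) ×-dec (x ∈? A₁) ×-dec (x ∈? B₂) ×-dec
    ((ω G (B₁ ∪ ⁅ x ⁆) <? ω G S₁) ⊎-dec perfect? G (A₂ ∪ ⁅ x ⁆))

  settled-or-movable : X ⊆ S₁ → (d : DivisionPair G S₁ S₂) → Settled X d ⊎ ∃ (Movable X d)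
  settled-or-movable {X = X} X⊆S₁ d@(divisionPair A₁ B₁ A₂ B₂ (A₁∪B₁≡S₁ , _) _)
    with any? (movable? X d)
  ... | yes movable = inj₂ movable
  ... | no stuck    = inj₁ λ x x∈X x∈A₁ x∈B₂ →
    let B₁⊆S₁ = subst (B₁ ⊆_) A₁∪B₁≡S₁ (q⊆p∪q A₁ B₁)
        unmovable = λ reason → stuck (x , x∈X , x∈A₁ , x∈B₂ , reason)
    in  ≤-antisym (ω-mono G (p⊆r⇒x∈r⇒p∪⁅x⁆⊆r B₁⊆S₁ (X⊆S₁ x∈X))) (≮⇒≥ (unmovable ∘ inj₁))
      , unmovable ∘ inj₂

  movable⇒reducible : (d : DivisionPair G S₁ S₂) {x : Fin n} → Movable X d x → Reducible d
  movable⇒reducible (divisionPair A₁ B₁ A₂ B₂ d₁ d₂@(_ , A₂∩B₂≡⊥ , _))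
                    (_ , x∈A₁ , x∈B₂ , inj₁ small) =
    divisionPair _ _ _ _ (move-to-B G d₁ x∈A₁ small) d₂ ,
    ⊆-⊂-trans (conflictSet-moveˡ (λ x∈A₂ → p∩q≡⊥⇒x∈p⇒x∉q A₂∩B₂≡⊥ x∈A₂ x∈B₂))
              (x∈p⇒p-x⊂p (x∈p∪q⁺ (inj₁ (x∈p∩q⁺ (x∈A₁ , x∈B₂)))))
  movable⇒reducible (divisionPair A₁ B₁ A₂ B₂ d₁@(_ , A₁∩B₁≡⊥ , _) d₂)
                    (_ , x∈A₁ , x∈B₂ , inj₂ perfect) =
    divisionPair _ _ _ _ d₁ (move-to-A G d₂ x∈B₂ perfect) ,
    ⊆-⊂-trans (conflictSet-moveʳ (p∩q≡⊥⇒x∈p⇒x∉q A₁∩B₁≡⊥ x∈A₁))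
              (x∈p⇒p-x⊂p (x∈p∪q⁺ (inj₁ (x∈p∩q⁺ (x∈A₁ , x∈B₂)))))

  Stable : Subset n → DivisionPair G S₁ S₂ → Set
  Stable X d = Settled X d × Settled X (swap d)

  stable-or-reducible : X ⊆ S₁ → X ⊆ S₂ → (d : DivisionPair G S₁ S₂) → Stable X d ⊎ Reducible d
  stable-or-reducible X⊆S₁ X⊆S₂ d
    with settled-or-movable X⊆S₁ d | settled-or-movable X⊆S₂ (swap d)
  ... | inj₁ settled₁       | inj₁ settled₂       = inj₁ (settled₁ , settled₂)
  ... | inj₂ (_ , movable) | _                    = inj₂ (movable⇒reducible d movable)
  ... | _                   | inj₂ (_ , movable) =
    let d′ , d′⊂swap-d = movable⇒reducible (swap d) movable
    in  inj₂ (swap d′ , subst₂ _⊂_ (sym (conflicts-swap d′)) (conflicts-swap d) d′⊂swap-d)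

  stable-pair : X ⊆ S₁ → X ⊆ S₂ → DivisionPair G S₁ S₂ → ∃ (Stable X)
  stable-pair X⊆S₁ X⊆S₂ =
    descent (On.wellFounded conflicts ⊂-wellFounded) (stable-or-reducible X⊆S₁ X⊆S₂)

lemma6 : {n : ℕ} (G : Graph n) → MinimallyNonPerfectlyDivisible G →
    (X V₁ V₂ : Subset n) → IsClique G X →
    Nonempty V₁ → Nonempty V₂ →
    V₁ ∩ V₂ ≡ ⊥ → V₁ ∪ V₂ ≡ ∁ X →
    (∀ u v → u ∈ V₁ → v ∈ V₂ → ¬ Adj G u v) →
    ∃₂ λ A₁ B₁ → ∃₂ λ A₂ B₂ →
      PerfectDivision G (X ∪ V₁) A₁ B₁ × PerfectDivision G (X ∪ V₂) A₂ B₂ ×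
      (∀ x → x ∈ X → x ∈ A₁ → x ∈ B₂ →
         (ω G (B₁ ∪ ⁅ x ⁆) ≡ ω G (X ∪ V₁)) × ¬ Perfect G (A₂ ∪ ⁅ x ⁆)) ×
      (∀ x → x ∈ X → x ∈ A₂ → x ∈ B₁ →
         (ω G (B₂ ∪ ⁅ x ⁆) ≡ ω G (X ∪ V₂)) × ¬ Perfect G (A₁ ∪ ⁅ x ⁆))
lemma6 G mnpd X V₁ V₂ _ (v₁ , v₁∈V₁) (v₂ , v₂∈V₂) V₁∩V₂≡⊥ V₁∪V₂≡∁X _
  with stable-pair {X = X} (p⊆p∪q V₁) (p⊆p∪q V₂)
         (initial-pair {G = G} mnpd
           (X∪V₁⊂⊤ V₁∩V₂≡⊥ V₁∪V₂≡∁X v₂∈V₂)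
           (X∪V₁⊂⊤ (trans (∩-comm V₂ V₁) V₁∩V₂≡⊥) (trans (∪-comm V₂ V₁) V₁∪V₂≡∁X) v₁∈V₁)
           (v₁ , q⊆p∪q X V₁ v₁∈V₁) (v₂ , q⊆p∪q X V₂ v₂∈V₂))
... | divisionPair A₁ B₁ A₂ B₂ d₁ d₂ , settled₁ , settled₂ =
  A₁ , B₁ , A₂ , B₂ , d₁ , d₂ , settled₁ , settled₂
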